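{- Let $(p_t)_{t\in[T]}$ with $p_t\in(t,T+n]$ be NAT predictions and let $\hat p_t(i)$ be the remedy predictions. Then for every round $t\in[T]$, writing $A=A_t(\sigma_t)$: (1) if $p_t>A$, then $\hat p_{t'}(\sigma_t)>A_{t'}(\sigma_t)$ for every $t'\in[t,\min\{T,A-1\}]$; (2) if $p_t<A$, then for every $t'\in[t,\min\{T,A-1\}]$, either $\hat p_{t'}(\sigma_t)<A_{t'}(\sigma_t)$ or $\hat p_{t'}(\sigma_t)=Z>A_{t'}(\sigma_t)$; moreover, if in addition $t'\le p_t-1$, then $\hat p_{t'}(\sigma_t)<A_{t'}(\sigma_t)$; (3) if $p_t=A$, then $\hat p_{t'}(\sigma_t)=A_{t'}(\sigma_t)$ for every $t'\in[t,\min\{T,A-1\}]$.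
   Context: Request sequence $\sigma\in[n]^T$ augmented with virtual requests $\sigma_{T+i}=i$ ($i\in[n]$); next arrival time $A_t(i)=\min\{t'>t:\sigma_{t'}=i\}$. Fix an integer $Z>T+n$. Remedy predictions: $\hat p_1(i)=p_1$ if $i=\sigma_1$ and $\hat p_1(i)=Z+1$ otherwise; for $t\in[2,T]$, $\hat p_t(i)=p_t$ if $i=\sigma_t$; $\hat p_t(i)=Z$ if $\hat p_{t-1}(i)\le t$, $i\ne\sigma_t$ and $\hat p_{t-1}(i)\le\hat p_{t-1}(\sigma_t)<Z$; and $\hat p_t(i)=\hat p_{t-1}(i)$ otherwise. -}

module Defs where

open import Data.Nat using (ℕ; zero; suc; _+_; _∸_; _≤ᵇ_; _<ᵇ_; _≡ᵇ_)
open import Data.Fin using (Fin; toℕ; _≟_)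
open import Data.Bool using (Bool; true; false; _∧_; _∨_; if_then_else_)
open import Relation.Nullary.Decidable using (⌊_⌋)

-- Rounds are numbered 1..T; σ t is the page requested in round t (only
-- values for 1 ≤ t ≤ T matter).
-- Augmented sequence: round T + i requests page i (i ∈ [n]); with 0-based
-- Fin, page j : Fin n is the virtual request at time T + suc (toℕ j).

isReq : (n T : ℕ) → (ℕ → Fin n) → ℕ → Fin n → Bool
isReq n T σ t i =
  ((1 ≤ᵇ t) ∧ ((t ≤ᵇ T) ∧ ⌊ σ t ≟ i ⌋)) ∨ (t ≡ᵇ (T + suc (toℕ i)))

-- first s' ≥ s (searching at most fuel+1 positions) with isReq s' i;
-- falls back to s + fuel + 1... when none is found (never happens in use)
searchFrom : (n T : ℕ) → (ℕ → Fin n) → Fin n → ℕ → ℕ → ℕ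
searchFrom n T σ i s zero = s
searchFrom n T σ i s (suc f) =
  if isReq n T σ s i then s else searchFrom n T σ i (suc s) f

-- next arrival time  A_t(i) = min { t' > t : σ_{t'} = i }  (augmented σ);
-- searches t+1 .. T+n, which always contains an arrival when t ≤ T.
A : (n T : ℕ) → (ℕ → Fin n) → ℕ → Fin n → ℕ
A n T σ t i = searchFrom n T σ i (suc t) (T + n ∸ t)

remedyStep : (n : ℕ) → (ℕ → Fin n) → (ℕ → ℕ) → (Z t : ℕ) →
             (Fin n → ℕ) → Fin n → ℕ
remedyStep n σ p Z t prev i =
  if ⌊ σ t ≟ i ⌋ then p t
  else (if (prev i ≤ᵇ t) ∧ ((prev i ≤ᵇ prev (σ t)) ∧ (prev (σ t) <ᵇ Z))
        then Z else prev i)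

phat : (n T : ℕ) → (ℕ → Fin n) → (ℕ → ℕ) → (Z : ℕ) → ℕ → Fin n → ℕ
phat n T σ p Z zero i = suc Z   -- junk, round 0 does not exist
phat n T σ p Z (suc zero) i =
  if ⌊ σ 1 ≟ i ⌋ then p 1 else suc Z
phat n T σ p Z (suc (suc k)) i =
  remedyStep n σ p Z (suc (suc k)) (phat n T σ p Z (suc k)) i

{-# OPTIONS --safe #-}
module Submission where

open import Defs
open import Data.Nat using (ℕ; zero; suc; _+_; _∸_; _≤_; _<_; _>_; _≤′_; ≤′-refl; ≤′-step; _≤ᵇ_; _<ᵇ_; s≤s)
open import Data.Nat.Properties
  using (≤-trans; ≤-<-trans; <-≤-trans; <-irrefl; m≤n⇒m<n∨m≡n; m≤m+n; +-suc; +-monoʳ-≤;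
         n≤1+n; ≤⇒≤′; ≤′⇒≤; ≤ᵇ⇒≤; ≤⇒≤ᵇ; ≡⇒≡ᵇ)
open import Data.Fin using (Fin; toℕ; _≟_)
open import Data.Fin.Properties using (toℕ<n)
open import Data.Bool using (true; false; _∧_)
open import Data.Bool.Properties using (T-≡; ∨-zeroʳ)
open import Data.Empty using (⊥-elim)
open import Data.Product using (_×_; _,_)
open import Data.Sum using (_⊎_; inj₁; inj₂)
open import Function.Bundles using (Equivalence)
open import Relation.Nullary using (yes; no)
open import Relation.Binary.PropositionalEquality using (_≡_; _≢_; refl; sym; trans; subst)

-- Between round t and the next request A of σ_t, the page σ_t is
-- never requested, so A_{t'}(σ_t) stays equal to A, and the only change the
-- remedy can make to p̂(σ_t) is to reset it to Z, which it does only once the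
-- prediction p_t has expired (p_t ≤ t').

m∸n≡suc[m∸suc[n]] : ∀ m n → n < m → m ∸ n ≡ suc (m ∸ suc n)
m∸n≡suc[m∸suc[n]] (suc m) zero    _         = refl
m∸n≡suc[m∸suc[n]] (suc m) (suc n) (s≤s n<m) = m∸n≡suc[m∸suc[n]] m n n<m

≤∸1⇒< : ∀ {m k} → 0 < m → m ≤ k ∸ 1 → m < k
≤∸1⇒< {k = zero}  (s≤s _) ()
≤∸1⇒< {k = suc k} _       m≤k = s≤s m≤k

module NextArrival (n T : ℕ) (σ : ℕ → Fin n) (i : Fin n) where

  isReq-virtual : isReq n T σ (T + suc (toℕ i)) i ≡ true
  isReq-virtual
    rewrite Equivalence.to T-≡ (≡⇒≡ᵇ (T + suc (toℕ i)) (T + suc (toℕ i)) refl) = ∨-zeroʳ _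

  isReq-σ : ∀ {s} → suc s ≤ T → σ (suc s) ≡ i → isReq n T σ (suc s) i ≡ true
  isReq-σ {s} s<T refl rewrite Equivalence.to T-≡ (≤⇒≤ᵇ s<T) with σ (suc s) ≟ σ (suc s)
  ... | yes _  = refl
  ... | no ≢   = ⊥-elim (≢ refl)

  searchFrom-≤ : ∀ s f {m} → isReq n T σ m i ≡ true → s ≤ m → searchFrom n T σ i s f ≤ m
  searchFrom-≤ s zero    _   s≤m = s≤m
  searchFrom-≤ s (suc f) req s≤m with isReq n T σ s i in e | m≤n⇒m<n∨m≡n s≤m
  ... | true  | _         = s≤m
  ... | false | inj₁ s<m  = searchFrom-≤ (suc s) f req s<m
  ... | false | inj₂ refl with trans (sym e) req
  ...   | ()

  A≤T+n : ∀ {t} → t ≤ T → A n T σ t i ≤ T + n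
  A≤T+n {t} t≤T = ≤-trans (searchFrom-≤ (suc t) (T + n ∸ t) isReq-virtual t<virtual)
                          (+-monoʳ-≤ T (toℕ<n i))
    where
    t<virtual : t < T + suc (toℕ i)
    t<virtual = ≤-<-trans t≤T (subst (T <_) (sym (+-suc T (toℕ i))) (s≤s (m≤m+n T (toℕ i))))

  A-hit : ∀ {t} → t < T + n → isReq n T σ (suc t) i ≡ true → A n T σ t i ≡ suc t
  A-hit {t} t<T+n req rewrite m∸n≡suc[m∸suc[n]] (T + n) t t<T+n | req = refl

  A-miss : ∀ {t} → t < T + n → isReq n T σ (suc t) i ≡ false →
           A n T σ t i ≡ A n T σ (suc t) i
  A-miss {t} t<T+n req rewrite m∸n≡suc[m∸suc[n]] (T + n) t t<T+n | req = refl

  isReq-before-A : ∀ {t} → t < T + n → suc t < A n T σ t i → isReq n T σ (suc t) i ≡ false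
  isReq-before-A {t} t<T+n st<A with isReq n T σ (suc t) i in req
  ... | true  = ⊥-elim (<-irrefl (sym (A-hit t<T+n req)) st<A)
  ... | false = refl

  A-constant : ∀ {t t'} → t ≤′ t' → t' ≤ T → t' < A n T σ t i → A n T σ t' i ≡ A n T σ t i
  A-constant ≤′-refl _ _ = refl
  A-constant {t} (≤′-step {t'} t≤′t') st'≤T st'<A =
    trans (sym (A-miss t'<T+n (isReq-before-A t'<T+n (subst (suc t' <_) (sym A-t') st'<A)))) A-t'
    where
    t'<T+n : t' < T + n
    t'<T+n = <-≤-trans st'≤T (m≤m+n T n)
    A-t' : A n T σ t' i ≡ A n T σ t i
    A-t' = A-constant t≤′t' (≤-trans (n≤1+n t') st'≤T) (≤-<-trans (n≤1+n t') st'<A)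

  not-requested-before-A : ∀ {t t'} → t ≤′ t' → suc t' ≤ T → suc t' < A n T σ t i →
                           σ (suc t') ≢ i
  not-requested-before-A {t} {t'} t≤′t' st'≤T st'<A σ≡i =
    true≢false (trans (sym (isReq-σ st'≤T σ≡i)) (isReq-before-A t'<T+n st'<A'))
    where
    true≢false : true ≢ false
    true≢false ()
    t'<T+n : t' < T + n
    t'<T+n = <-≤-trans st'≤T (m≤m+n T n)
    st'<A' : suc t' < A n T σ t' i
    st'<A' = subst (suc t' <_) (sym (A-constant t≤′t' (≤-trans (n≤1+n t') st'≤T)
                                                      (≤-<-trans (n≤1+n t') st'<A))) st'<A

open NextArrival

-- The values p̂_s(σ_t) can take before the next request of σ_t, where P = p_t.
data RemedyOf (Z P s : ℕ) : ℕ → Set where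
  kept  : RemedyOf Z P s P
  reset : P ≤ s → RemedyOf Z P s Z

RemedyOf-suc : ∀ {Z P s v} → RemedyOf Z P s v → RemedyOf Z P (suc s) v
RemedyOf-suc kept        = kept
RemedyOf-suc (reset P≤s) = reset (≤-trans P≤s (n≤1+n _))

RemedyOf-reset : ∀ {Z P s v} → (v ≤ᵇ s) ≡ true → RemedyOf Z P s v → RemedyOf Z P s Z
RemedyOf-reset v≤s kept        = reset (≤ᵇ⇒≤ _ _ (Equivalence.from T-≡ v≤s))
RemedyOf-reset _   (reset P≤s) = reset P≤s

RemedyOf-above : ∀ {Z P s v a} → RemedyOf Z P s v → a < P → a < Z → a < v
RemedyOf-above kept      a<P _   = a<P
RemedyOf-above (reset _) _   a<Z = a<Z

RemedyOf-below : ∀ {Z P s v a} → RemedyOf Z P s v → P < a → a < Z → v < a ⊎ (v ≡ Z × Z > a)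
RemedyOf-below kept      P<a _   = inj₁ P<a
RemedyOf-below (reset _) _   a<Z = inj₂ (refl , a<Z)

RemedyOf-unexpired : ∀ {Z P s v} → RemedyOf Z P s v → s < P → v ≡ P
RemedyOf-unexpired kept        _   = refl
RemedyOf-unexpired (reset P≤s) s<P = ⊥-elim (<-irrefl refl (≤-<-trans P≤s s<P))

module Remedy (n T : ℕ) (σ : ℕ → Fin n) (p : ℕ → ℕ) (Z : ℕ) where

  remedyStep-RemedyOf : ∀ {P s} (prev : Fin n → ℕ) (i : Fin n) → σ s ≢ i →
    RemedyOf Z P s (prev i) → RemedyOf Z P s (remedyStep n σ p Z s prev i)
  remedyStep-RemedyOf {s = s} prev i σs≢i inv with σ s ≟ i
  ... | yes σs≡i = ⊥-elim (σs≢i σs≡i)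
  ... | no _ with prev i ≤ᵇ s in expired
  ...   | false = inv
  ...   | true with (prev i ≤ᵇ prev (σ s)) ∧ (prev (σ s) <ᵇ Z)
  ...     | false = inv
  ...     | true  = RemedyOf-reset expired inv

  phat-suc : ∀ {t} → 0 < t → (i : Fin n) →
    phat n T σ p Z (suc t) i ≡ remedyStep n σ p Z (suc t) (phat n T σ p Z t) i
  phat-suc {suc t} _ i = refl

  phat-self : ∀ {t} → 0 < t → phat n T σ p Z t (σ t) ≡ p t
  phat-self {suc zero} _ with σ 1 ≟ σ 1
  ... | yes _ = refl
  ... | no ≢  = ⊥-elim (≢ refl)
  phat-self {suc (suc t)} _ with σ (suc (suc t)) ≟ σ (suc (suc t))
  ... | yes _ = refl
  ... | no ≢  = ⊥-elim (≢ refl)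

  phat-RemedyOf : ∀ {t t'} → 0 < t → t ≤′ t' → t' ≤ T → t' < A n T σ t (σ t) →
    RemedyOf Z (p t) t' (phat n T σ p Z t' (σ t))
  phat-RemedyOf 0<t ≤′-refl _ _ =
    subst (RemedyOf Z _ _) (sym (phat-self 0<t)) kept
  phat-RemedyOf {t} 0<t (≤′-step {t'} t≤′t') st'≤T st'<A =
    subst (RemedyOf Z (p t) (suc t')) (sym (phat-suc (<-≤-trans 0<t (≤′⇒≤ t≤′t')) (σ t)))
      (remedyStep-RemedyOf (phat n T σ p Z t') (σ t)
        (not-requested-before-A n T σ (σ t) t≤′t' st'≤T st'<A)
        (RemedyOf-suc (phat-RemedyOf 0<t t≤′t' (≤-trans (n≤1+n t') st'≤T)
                                            (≤-<-trans (n≤1+n t') st'<A))))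

lemma6 : (n T Z : ℕ) (σ : ℕ → Fin n) (p : ℕ → ℕ) →
    Z > T + n →
    (∀ t → 1 ≤ t → t ≤ T → (t < p t) × (p t ≤ T + n)) →
    ∀ t → 1 ≤ t → t ≤ T →
      ((p t > A n T σ t (σ t)) →
        ∀ t' → t ≤ t' → t' ≤ T → t' ≤ A n T σ t (σ t) ∸ 1 →
          phat n T σ p Z t' (σ t) > A n T σ t' (σ t))
      × ((p t < A n T σ t (σ t)) →
        ∀ t' → t ≤ t' → t' ≤ T → t' ≤ A n T σ t (σ t) ∸ 1 →
          ((phat n T σ p Z t' (σ t) < A n T σ t' (σ t))
            ⊎ ((phat n T σ p Z t' (σ t) ≡ Z) × (Z > A n T σ t' (σ t))))
          × (t' ≤ p t ∸ 1 → phat n T σ p Z t' (σ t) < A n T σ t' (σ t)))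
      × ((p t ≡ A n T σ t (σ t)) →
        ∀ t' → t ≤ t' → t' ≤ T → t' ≤ A n T σ t (σ t) ∸ 1 →
          phat n T σ p Z t' (σ t) ≡ A n T σ t' (σ t))
lemma6 n T Z σ p Z>T+n _ t 0<t t≤T =
    (λ a<p t' t≤t' t'≤T t'≤a∸1 →
       RemedyOf-above (trace t≤t' t'≤T t'≤a∸1)
                      (subst (_< p t) (sym (A-window t≤t' t'≤T t'≤a∸1)) a<p) (A<Z t'≤T))
  , (λ p<a t' t≤t' t'≤T t'≤a∸1 →
       let p<A' = subst (p t <_) (sym (A-window t≤t' t'≤T t'≤a∸1)) p<a in
         RemedyOf-below (trace t≤t' t'≤T t'≤a∸1) p<A' (A<Z t'≤T)
       , λ t'≤p∸1 → subst (_< _) (sym (RemedyOf-unexpired (trace t≤t' t'≤T t'≤a∸1)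
                                        (≤∸1⇒< (<-≤-trans 0<t t≤t') t'≤p∸1))) p<A')
  , (λ p≡a t' t≤t' t'≤T t'≤a∸1 →
       trans (RemedyOf-unexpired (trace t≤t' t'≤T t'≤a∸1)
                                 (subst (t' <_) (sym p≡a) (window-< t≤t' t'≤a∸1)))
             (trans p≡a (sym (A-window t≤t' t'≤T t'≤a∸1))))
  where
  open Remedy n T σ p Z
  a : ℕ
  a = A n T σ t (σ t)
  A<Z : ∀ {t'} → t' ≤ T → A n T σ t' (σ t) < Z
  A<Z t'≤T = ≤-<-trans (A≤T+n n T σ (σ t) t'≤T) Z>T+n
  window-< : ∀ {t'} → t ≤ t' → t' ≤ a ∸ 1 → t' < a
  window-< t≤t' = ≤∸1⇒< (<-≤-trans 0<t t≤t')
  A-window : ∀ {t'} → t ≤ t' → t' ≤ T → t' ≤ a ∸ 1 → A n T σ t' (σ t) ≡ a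
  A-window t≤t' t'≤T t'≤a∸1 = A-constant n T σ (σ t) (≤⇒≤′ t≤t') t'≤T (window-< t≤t' t'≤a∸1)
  trace : ∀ {t'} → t ≤ t' → t' ≤ T → t' ≤ a ∸ 1 → RemedyOf Z (p t) t' (phat n T σ p Z t' (σ t))
  trace t≤t' t'≤T t'≤a∸1 = phat-RemedyOf 0<t (≤⇒≤′ t≤t') t'≤T (window-< t≤t' t'≤a∸1)
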